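{- Let $(\mathbb{N}^2,\cdot)$ be the structure with $\cdot:\mathbb{N}^2\times\mathbb{N}^2\to\mathcal{P}(\mathbb{N}^2)$ given by $(m'',n'')\in(m,n)\cdot(m',n')$ iff $\max\{m,m'\}\le m''\le m+m'$ and $\max\{n,n'\}\le n''\le n+n'$. Define $f:\mathcal{P}_{\mathrm{fin}}(\mathbb{N})\to\mathbb{N}^2$ by $f(X)=(|X\cap2\mathbb{N}|,\,|X\cap(2\mathbb{N}+1)|)$, where $2\mathbb{N}$ and $2\mathbb{N}+1$ are the even and odd natural numbers. Then $f$ is a p-morphism from $(\mathcal{P}_{\mathrm{fin}}(\mathbb{N}),\cup)$ to $(\mathbb{N}^2,\cdot)$; that is: (forth) if $X\cup Y=Z$ then $f(Z)\in f(X)\cdot f(Y)$; and (back) if $z'\in f(X)\cdot y'$ then there are finite $Y,Z\subseteq\mathbb{N}$ with $f(Y)=y'$, $f(Z)=z'$ and $X\cup Y=Z$.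
   Context: $\mathcal{P}_{\mathrm{fin}}(\mathbb{N})$ is the set of finite subsets of $\mathbb{N}$; $\mathbb{N}$ includes $0$. -}

module Defs where

open import Data.Nat using (ℕ; _+_; _≤_; _⊔_; _%_)
open import Data.Nat.Properties using (_≟_)
open import Data.List using (List; length; filter)
open import Data.List.Membership.Propositional using (_∈_)
open import Data.List.Relation.Unary.Unique.Propositional using (Unique)
open import Data.Product using (Σ; _×_; _,_; proj₁)
open import Data.Sum using (_⊎_)
open import Function.Bundles using (_⇔_)
open import Relation.Unary using (Decidable)
open import Relation.Binary.PropositionalEquality using (_≡_)

FinSub : Set
FinSub = Σ (List ℕ) Unique

_∈ₛ_ : ℕ → FinSub → Set
n ∈ₛ X = n ∈ proj₁ X

IsUnion : FinSub → FinSub → FinSub → Set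
IsUnion X Y Z = ∀ n → (n ∈ₛ Z) ⇔ (n ∈ₛ X ⊎ n ∈ₛ Y)

Even Odd : ℕ → Set
Even n = n % 2 ≡ 0
Odd n = n % 2 ≡ 1

even? : Decidable Even
even? n = n % 2 ≟ 0

odd? : Decidable Odd
odd? n = n % 2 ≟ 1

f : FinSub → ℕ × ℕ
f X = length (filter even? (proj₁ X)) , length (filter odd? (proj₁ X))

_∈_·_ : ℕ × ℕ → ℕ × ℕ → ℕ × ℕ → Set
(m″ , n″) ∈ (m , n) · (m′ , n′) =
  (m ⊔ m′ ≤ m″ × m″ ≤ m + m′) × (n ⊔ n′ ≤ n″ × n″ ≤ n + n′)

module Submission where

-- Forth: the even (odd) part of X ∪ Y contains those of X and of Y and is
-- covered by their concatenation, so its size lies between their maximum and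
-- their sum. Back: in each parity class, x ⊔ a ≤ c ≤ x + a means that c = x + k
-- and a = j + k with j ≤ x, where x is the size of that class in X. So Y is
-- made of j elements of X and k numbers of the right parity beyond max X, and
-- then Z = X ∪ Y has c elements of that parity.

open import Defs
open import Level using (Level)
open import Data.Empty using (⊥-elim)
open import Data.Nat using (ℕ; suc; _+_; _*_; _∸_; _≤_; _<_; _⊔_; _%_; z≤n; s≤s)
open import Data.Nat.Properties
open import Data.Nat.DivMod using ([m+kn]%n≡m%n; m*n%n≡0)
open import Data.List using (List; []; _∷_; _++_; length; filter; take; applyUpTo)
open import Data.List.Properties using
  (length-++; filter-++; filter-all; filter-none; length-take; length-applyUpTo; length-removeAt′)
open import Data.List.Extrema.Nat using (max; xs≤max)
open import Data.List.Membership.Propositional using (_∈_; _─_)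
open import Data.List.Membership.Propositional.Properties using (∈-++⁺ˡ; ∈-++⁺ʳ; ∈-++⁻)
open import Data.List.Relation.Unary.Any using (here; there; index)
open import Data.List.Relation.Unary.All as All using (All)
open import Data.List.Relation.Unary.AllPairs using (_∷_)
open import Data.List.Relation.Unary.All.Properties
  using (take⁺; all-filter; applyUpTo⁺₂) renaming (++⁺ to All-++⁺)
open import Data.List.Relation.Unary.Unique.Propositional using (Unique)
import Data.List.Relation.Unary.Unique.Propositional.Properties as Unique
open import Data.List.Relation.Binary.Subset.Propositional using (_⊆_)
open import Data.List.Relation.Binary.Subset.Propositional.Properties
  using (filter-⊆; filter⁺′; All-resp-⊇)
open import Data.List.Relation.Binary.Disjoint.Propositional using (Disjoint)
open import Data.Product using (Σ; ∃₂; _×_; _,_; proj₁; proj₂; zip′)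
open import Data.Sum using (_⊎_; inj₁; inj₂; [_,_]′)
open import Function using (_∘_; id)
open import Function.Bundles using (_⇔_; mk⇔; Equivalence)
open import Relation.Nullary using (¬_)
open import Relation.Unary using (Pred; Decidable; ∁)
open import Relation.Binary.PropositionalEquality

private
  variable
    a p q : Level
    A : Set a

∈-─⁺ : ∀ {x y : A} {ys} (x∈ys : x ∈ ys) → y ∈ ys → x ≢ y → y ∈ ys ─ x∈ys
∈-─⁺ (here refl) (here refl) x≢y = ⊥-elim (x≢y refl)
∈-─⁺ (here refl) (there y∈ys) _  = y∈ys
∈-─⁺ (there _)   (here refl) _   = here refl
∈-─⁺ (there x∈ys) (there y∈ys) x≢y = there (∈-─⁺ x∈ys y∈ys x≢y)

Unique-⊆⇒length≤ : ∀ {xs ys : List A} → Unique xs → xs ⊆ ys → length xs ≤ length ys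
Unique-⊆⇒length≤ {xs = []} _ _ = z≤n
Unique-⊆⇒length≤ {xs = x ∷ xs} {ys} (x∉xs ∷ xs!) xs⊆ys = begin
  suc (length xs)          ≤⟨ s≤s (Unique-⊆⇒length≤ xs! xs⊆ys─x) ⟩
  suc (length (ys ─ x∈ys)) ≡⟨ length-removeAt′ ys (index x∈ys) ⟨
  length ys                ∎
  where
  open ≤-Reasoning
  x∈ys = xs⊆ys (here refl)
  xs⊆ys─x : xs ⊆ ys ─ x∈ys
  xs⊆ys─x v∈xs = ∈-─⁺ x∈ys (xs⊆ys (there v∈xs)) (All.lookup x∉xs v∈xs)

take-⊆ : ∀ n (xs : List A) → take n xs ⊆ xs
take-⊆ (suc n) (x ∷ xs) (here refl)   = here refl
take-⊆ (suc n) (x ∷ xs) (there v∈xs) = there (take-⊆ n xs v∈xs)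

All⇒Disjoint : ∀ {P : Pred A p} {Q : Pred A q} {xs ys} →
               (∀ v → P v → ¬ Q v) → All P xs → All Q ys → Disjoint xs ys
All⇒Disjoint P⇒¬Q Pxs Qys (v∈xs , v∈ys) =
  P⇒¬Q _ (All.lookup Pxs v∈xs) (All.lookup Qys v∈ys)

module _ {P : Pred A p} (P? : Decidable P) where

  length-filter-++ : ∀ xs ys →
    length (filter P? (xs ++ ys)) ≡ length (filter P? xs) + length (filter P? ys)
  length-filter-++ xs ys = trans (cong length (filter-++ P? xs ys)) (length-++ (filter P? xs))

  length-filter-all : ∀ {xs} → All P xs → length (filter P? xs) ≡ length xs
  length-filter-all = cong length ∘ filter-all P?

  length-filter-none : ∀ {xs} → All (∁ P) xs → length (filter P? xs) ≡ 0
  length-filter-none = cong length ∘ filter-none P?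

  length-filter-mono : ∀ {xs ys} → Unique xs → xs ⊆ ys →
                       length (filter P? xs) ≤ length (filter P? ys)
  length-filter-mono xs! xs⊆ys =
    Unique-⊆⇒length≤ (Unique.filter⁺ P? xs!) (filter⁺′ P? P? id xs⊆ys)

module _ {P : Pred ℕ p} (P? : Decidable P) where

  private
    #_ : FinSub → ℕ
    # X = length (filter P? (proj₁ X))

  #-union : ∀ X Y Z → IsUnion X Y Z → # X ⊔ # Y ≤ # Z × # Z ≤ # X + # Y
  #-union (xs , xs!) (ys , ys!) (zs , zs!) X∪Y≡Z =
    ⊔-lub (length-filter-mono P? xs! (from ∘ inj₁))
          (length-filter-mono P? ys! (from ∘ inj₂)) ,
    ≤-trans (length-filter-mono P? zs! zs⊆xs++ys) (≤-reflexive (length-filter-++ P? xs ys))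
    where
    open module X∪Y≡Z {v} = Equivalence (X∪Y≡Z v)
    zs⊆xs++ys : zs ⊆ xs ++ ys
    zs⊆xs++ys = [ ∈-++⁺ˡ , ∈-++⁺ʳ xs ]′ ∘ to

∈-++-absorb : ∀ {xs ys zs : List A} → ys ⊆ xs →
              ∀ {v} → v ∈ xs ++ zs ⇔ (v ∈ xs ⊎ v ∈ ys ++ zs)
∈-++-absorb {xs = xs} {ys} ys⊆xs = mk⇔
  ([ inj₁ , inj₂ ∘ ∈-++⁺ʳ ys ]′ ∘ ∈-++⁻ xs)
  [ ∈-++⁺ˡ , [ ∈-++⁺ˡ ∘ ys⊆xs , ∈-++⁺ʳ xs ]′ ∘ ∈-++⁻ ys ]′

even⇒¬odd : ∀ n → Even n → ¬ Odd n
even⇒¬odd _ n%2≡0 n%2≡1 with () ← trans (sym n%2≡0) n%2≡1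

odd⇒¬even : ∀ n → Odd n → ¬ Even n
odd⇒¬even n n-odd n-even = even⇒¬odd n n-even n-odd

parities : List ℕ → ℕ × ℕ
parities xs = length (filter even? xs) , length (filter odd? xs)

parities-++ : ∀ xs ys → parities (xs ++ ys) ≡ zip′ _+_ _+_ (parities xs) (parities ys)
parities-++ xs ys = cong₂ _,_ (length-filter-++ even? xs ys) (length-filter-++ odd? xs ys)

parities-evens++odds : ∀ {es os} → All Even es → All Odd os →
                       parities (es ++ os) ≡ (length es , length os)
parities-evens++odds {es} {os} es-even os-odd =
  trans (parities-++ es os) (cong₂ _,_ evens-count odds-count)
  where
  evens-count : length (filter even? es) + length (filter even? os) ≡ length es
  evens-count = trans
    (cong₂ _+_ (length-filter-all even? es-even)
               (length-filter-none even? (All.map (λ {v} → odd⇒¬even v) os-odd)))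
    (+-identityʳ (length es))
  odds-count : length (filter odd? es) + length (filter odd? os) ≡ length os
  odds-count = cong₂ _+_ (length-filter-none odd? (All.map (λ {v} → even⇒¬odd v) es-even))
                         (length-filter-all odd? os-odd)

stride2 : ℕ → ℕ → List ℕ
stride2 s = applyUpTo (λ i → s + i * 2)

length-stride2 : ∀ s k → length (stride2 s k) ≡ k
length-stride2 s = length-applyUpTo _

stride2-parity : ∀ s k → All (λ v → v % 2 ≡ s % 2) (stride2 s k)
stride2-parity s k = applyUpTo⁺₂ _ k (λ i → [m+kn]%n≡m%n s i 2)

stride2-≥ : ∀ s k → All (s ≤_) (stride2 s k)
stride2-≥ s k = applyUpTo⁺₂ _ k (λ i → m≤m+n s (i * 2))

stride2-unique : ∀ s k → Unique (stride2 s k)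
stride2-unique s k = Unique.applyUpTo⁺₁ _ k (λ i<j _ → <⇒≢ (+-monoʳ-< s (*-monoˡ-< 2 i<j)))

overlap-split : ∀ {x a c} → x ⊔ a ≤ c → c ≤ x + a →
                ∃₂ λ j k → j ≤ x × j + k ≡ a × x + k ≡ c
overlap-split {x} {a} {c} x⊔a≤c c≤x+a =
  a ∸ k , k , m≤n+o⇒m∸n≤o a k a≤k+x , m∸n+n≡m k≤a , m+[n∸m]≡n x≤c
  where
  k = c ∸ x
  x≤c = m⊔n≤o⇒m≤o x a x⊔a≤c
  k≤a = m≤n+o⇒m∸n≤o c x c≤x+a
  a≤k+x : a ≤ k + x
  a≤k+x = ≤-trans (m⊔n≤o⇒n≤o x a x⊔a≤c)
                  (≤-reflexive (trans (sym (m+[n∸m]≡n x≤c)) (+-comm x k)))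

overlapping-union : (X : FinSub) {j j′ : ℕ} (k k′ : ℕ) →
  j ≤ proj₁ (f X) → j′ ≤ proj₂ (f X) →
  Σ FinSub λ Y → Σ FinSub λ Z →
    f Y ≡ (j + k , j′ + k′) × f Z ≡ zip′ _+_ _+_ (f X) (k , k′) × IsUnion X Y Z
overlapping-union (xs , xs!) {j} {j′} k k′ j≤ j′≤ =
  (T ++ F , T++F!) , (xs ++ F , xs++F!) ,
  trans (parities-++ T F) (cong₂ (zip′ _+_ _+_) parities-T parities-F) ,
  trans (parities-++ xs F) (cong (zip′ _+_ _+_ (parities xs)) parities-F) ,
  (λ _ → ∈-++-absorb {zs = F} T⊆xs)
  where
  M = suc (max 0 xs)
  N = M * 2
  Fe = stride2 N k
  Fo = stride2 (suc N) k′
  F = Fe ++ Fo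
  Te = take j (filter even? xs)
  To = take j′ (filter odd? xs)
  T = Te ++ To

  Fe-even : All Even Fe
  Fe-even = All.map (λ v%2≡N%2 → trans v%2≡N%2 (m*n%n≡0 M 2)) (stride2-parity N k)
  Fo-odd : All Odd Fo
  Fo-odd = All.map (λ v%2≡1+N%2 → trans v%2≡1+N%2 ([m+kn]%n≡m%n 1 M 2))
                   (stride2-parity (suc N) k′)
  Te-even : All Even Te
  Te-even = take⁺ j (all-filter even? xs)
  To-odd : All Odd To
  To-odd = take⁺ j′ (all-filter odd? xs)

  T⊆xs : T ⊆ xs
  T⊆xs = [ filter-⊆ even? xs ∘ take-⊆ j _ , filter-⊆ odd? xs ∘ take-⊆ j′ _ ]′ ∘ ∈-++⁻ Te
  xs<N : All (_< N) xs
  xs<N = All.map (λ v≤max → <-≤-trans (s≤s v≤max) (m≤m*n M 2)) (xs≤max 0 xs)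
  N≤F : All (N ≤_) F
  N≤F = All-++⁺ (stride2-≥ N k) (All.map (≤-trans (n≤1+n N)) (stride2-≥ (suc N) k′))

  F! : Unique F
  F! = Unique.++⁺ (stride2-unique N k) (stride2-unique (suc N) k′)
                  (All⇒Disjoint even⇒¬odd Fe-even Fo-odd)
  T! : Unique T
  T! = Unique.++⁺ (Unique.take⁺ j (Unique.filter⁺ even? xs!))
                  (Unique.take⁺ j′ (Unique.filter⁺ odd? xs!))
                  (All⇒Disjoint even⇒¬odd Te-even To-odd)
  T++F! : Unique (T ++ F)
  T++F! = Unique.++⁺ T! F! (All⇒Disjoint (λ _ → <⇒≱) (All-resp-⊇ T⊆xs xs<N) N≤F)
  xs++F! : Unique (xs ++ F)
  xs++F! = Unique.++⁺ xs! F! (All⇒Disjoint (λ _ → <⇒≱) xs<N N≤F)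

  parities-T : parities T ≡ (j , j′)
  parities-T = trans (parities-evens++odds Te-even To-odd)
    (cong₂ _,_ (trans (length-take j _) (m≤n⇒m⊓n≡m j≤))
               (trans (length-take j′ _) (m≤n⇒m⊓n≡m j′≤)))
  parities-F : parities F ≡ (k , k′)
  parities-F = trans (parities-evens++odds Fe-even Fo-odd)
    (cong₂ _,_ (length-stride2 N k) (length-stride2 (suc N) k′))

lemma5p4 : ((X Y Z : FinSub) → IsUnion X Y Z → f Z ∈ f X · f Y)
    × ((X : FinSub) (y′ z′ : ℕ × ℕ) → z′ ∈ f X · y′ →
    Σ FinSub (λ Y → Σ FinSub (λ Z → f Y ≡ y′ × f Z ≡ z′ × IsUnion X Y Z)))
lemma5p4 = forth , back
  where
  forth : (X Y Z : FinSub) → IsUnion X Y Z → f Z ∈ f X · f Y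
  forth X Y Z X∪Y≡Z = #-union even? X Y Z X∪Y≡Z , #-union odd? X Y Z X∪Y≡Z

  back : (X : FinSub) (y′ z′ : ℕ × ℕ) → z′ ∈ f X · y′ →
         Σ FinSub (λ Y → Σ FinSub (λ Z → f Y ≡ y′ × f Z ≡ z′ × IsUnion X Y Z))
  back X (a , b) (c , d) ((xe⊔a≤c , c≤xe+a) , (xo⊔b≤d , d≤xo+b))
    with j  , k  , j≤xe  , refl , refl ← overlap-split {a = a} xe⊔a≤c c≤xe+a
       | j′ , k′ , j′≤xo , refl , refl ← overlap-split {a = b} xo⊔b≤d d≤xo+b
    = overlapping-union X k k′ j≤xe j′≤xo
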